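{- Let $G=(V,E)$ be a connected bipartite graph of order $n=r+s\ge 4$ with stable sets $U,W$ such that $V=U\cup W$ and $1\le |U|=r\le s=|W|$. If $r\ge 3$ and $\lambda(\overline{G})=\lambda(G)+1$, then $\frac{3r}{2}\le s\le 2^r-1$.
   Context: $\overline{G}$ denotes the complement of $G$. A set $S\subseteq V$ is a locating-dominating set (LD-set) of $G$ if every vertex of $V\setminus S$ has a neighbor in $S$ and for any two distinct $u,v\in V\setminus S$, $N_G(u)\cap S\neq N_G(v)\cap S$. $\lambda(G)$ is the minimum cardinality of an LD-set of $G$. -}

module Defs where

open import Data.Nat using (ℕ; suc; _≤_)
open import Data.Bool using (Bool; true; false; not; _∧_)
open import Data.Fin using (Fin)
open import Data.Fin.Properties using (_≟_)
open import Data.Fin.Subset using (Subset; _∈_; _∉_; ∣_∣)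
open import Data.Product using (Σ; _×_; ∃-syntax)
open import Relation.Binary.PropositionalEquality using (_≡_; _≢_)
open import Relation.Nullary using (¬_)
open import Relation.Nullary.Decidable using (⌊_⌋)

record Graph (n : ℕ) : Set where
  field
    adj     : Fin n → Fin n → Bool
    adj-sym : ∀ u v → adj u v ≡ adj v u
    irrefl  : ∀ v → adj v v ≡ false
open Graph public

complement : ∀ {n} → Graph n → Graph n
complement {n} G = record
  { adj = λ u v → not (adj G u v) ∧ not ⌊ u ≟ v ⌋
  ; adj-sym = sym'
  ; irrefl = irr }
  where
  open import Relation.Nullary using (yes; no)
  open import Relation.Binary.PropositionalEquality using (refl; sym; cong₂; cong)
  sym' : ∀ u v → (not (adj G u v) ∧ not ⌊ u ≟ v ⌋) ≡ (not (adj G v u) ∧ not ⌊ v ≟ u ⌋)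
  sym' u v with u ≟ v | v ≟ u
  ... | yes _ | yes _ = cong₂ _∧_ (cong not (adj-sym G u v)) refl
  ... | yes p | no q = Data.Empty.⊥-elim (q (sym p))
    where import Data.Empty
  ... | no p | yes q = Data.Empty.⊥-elim (p (sym q))
    where import Data.Empty
  ... | no _ | no _ = cong₂ _∧_ (cong not (adj-sym G u v)) refl
  irr : ∀ v → (not (adj G v v) ∧ not ⌊ v ≟ v ⌋) ≡ false
  irr v with v ≟ v
  ... | yes _ = Data.Bool.Properties.∧-zeroʳ _
    where import Data.Bool.Properties
  ... | no ¬p = Data.Empty.⊥-elim (¬p refl)
    where import Data.Empty

_∼[_]_ : ∀ {n} → Fin n → Graph n → Fin n → Set
u ∼[ G ] v = adj G u v ≡ true

data Reach {n} (G : Graph n) : Fin n → Fin n → Set where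
  here : ∀ {u} → Reach G u u
  step : ∀ {u v w} → u ∼[ G ] v → Reach G v w → Reach G u w

Connected : ∀ {n} → Graph n → Set
Connected G = ∀ u v → Reach G u v

IsLDSet : ∀ {n} → Graph n → Subset n → Set
IsLDSet {n} G S =
  (∀ v → v ∉ S → ∃[ u ] (u ∈ S × v ∼[ G ] u))
  × (∀ u v → u ≢ v → u ∉ S → v ∉ S →
       ¬ (∀ w → w ∈ S → adj G u w ≡ adj G v w))

IsLocDomNumber : ∀ {n} → Graph n → ℕ → Set
IsLocDomNumber G k =
  (∃[ S ] (IsLDSet G S × ∣ S ∣ ≡ k))
  × (∀ S → IsLDSet G S → k ≤ ∣ S ∣)

IsBipartition : ∀ {n} → Graph n → Subset n → Set
IsBipartition G U =
  (∀ u v → u ∈ U → v ∈ U → adj G u v ≡ false)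
  × (∀ u v → u ∉ U → v ∉ U → adj G u v ≡ false)

-- Let S be a minimum LD-set of G.  As S is not an LD-set of Ḡ, some vertex outside S
-- is adjacent to all of S, which forces S to be a side; S = W will be impossible,
-- so S = U.  The neighbourhoods of the vertices of W are then s distinct non-empty
-- subsets of U, whence s + 1 ≤ 2^r.  Regarding them as a family F of points of the
-- cube {0,1}ⁿ, a swap argument (exchange u ∈ U for a neighbour w: the new set is
-- too small to be an LD-set of Ḡ) shows that every direction u ∈ U carries at
-- least two edges of F.  A general estimate for families of cube points, proved
-- by contracting one direction at a time, gives 2 + Σᵥ weight(edges of F in
-- direction v) ≤ 2∣F∣, where the weight of 0, 1, ≥ 2 edges is 0, 2, 3; so 3r + 2 ≤ 2s.
module Submission where

open import Defs
open import Data.Nat using (ℕ; zero; suc; _+_; _*_; _^_; _≤_; _∸_; _≤ᵇ_; _≤?_; z≤n; s≤s)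
open import Data.Nat.Properties
open import Data.Bool using (Bool; true; false; not; _∧_; _∨_; if_then_else_; T)
import Data.Bool.Properties as Bool
open import Data.Fin using (Fin; zero; suc)
open import Data.Fin.Properties using (any?; all?; ¬∀⟶∃¬) renaming (_≟_ to _≟ᶠ_; suc-injective to suc-injectiveᶠ)
open import Data.Fin.Subset using (Subset; _∈_; _∉_; _⊆_; ∁; ∣_∣; ⊥; ⁅_⁆; _∪_; _-_; inside; outside; Nonempty)
open import Data.Fin.Subset.Properties
  using (_∈?_; _⊆?_; nonempty?; Empty-unique; ∣⊥∣≡0; ∣p∣≤n; ∣⁅x⁆∣≡1; x∈⁅x⁆; p⊆q⇒∣p∣≤∣q∣;
         ⊆-antisym; ⊆-min; x∈∁p⇒x∉p; x∉∁p⇒x∈p; x∉p⇒x∈∁p; x∈p⇒x∉∁p; ∣∁p∣≡n∸∣p∣;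
         x∈p∪q⁺; x∈p∧x≢y⇒x∈p-y; x∈p⇒∣p-x∣<∣p∣)
open import Data.Vec using (Vec; []; _∷_; lookup; tabulate; updateAt; here; there)
open import Data.Vec.Properties
  using (≡-dec; lookup∘updateAt; lookup∘updateAt′; updateAt-commutes; lookup∘tabulate;
         tabulate∘lookup; tabulate-cong; lookup-replicate; []=⇒lookup)
open import Data.List using (List; []; _∷_; length)
open import Data.List.Relation.Unary.All using (All; []; _∷_)
import Data.List.Relation.Unary.All as All
open import Data.List.Relation.Unary.AllPairs using (AllPairs; []; _∷_)
open import Data.Product using (_×_; _,_; ∃-syntax; proj₁; proj₂)
open import Data.Sum using (_⊎_; inj₁; inj₂)
open import Function using (_∘_; Equivalence)
open import Relation.Binary.PropositionalEquality
open import Relation.Binary.Definitions using (DecidableEquality)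
open import Relation.Nullary using (¬_; yes; no; does; contradiction)
open import Relation.Nullary.Decidable using (¬?; _×-dec_; _→-dec_; decidable-stable; dec-true)
open import Algebra.Properties.CommutativeSemigroup +-commutativeSemigroup using (interchange)
open import Algebra.Properties.Semiring.Sum +-*-semiring
  using (sum; sum-cong-≗; ∑-distrib-+; sum-replicate-zero; *-distribˡ-sum)

bit : Bool → ℕ
bit true  = 1
bit false = 0

bit≤1 : ∀ b → bit b ≤ 1
bit≤1 true  = s≤s z≤n
bit≤1 false = z≤n

bit-∨-∧ : ∀ a b → bit (a ∨ b) + bit (a ∧ b) ≡ bit a + bit b
bit-∨-∧ true  true  = refl
bit-∨-∧ true  false = refl
bit-∨-∧ false true  = refl
bit-∨-∧ false false = refl

bit-∧≤∨ : ∀ a b → bit (a ∧ b) ≤ bit (a ∨ b)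
bit-∧≤∨ true  b     = bit≤1 b
bit-∧≤∨ false true  = z≤n
bit-∧≤∨ false false = z≤n

all2 : (Bool → Bool) → Bool
all2 p = p false ∧ p true

all2-sound : ∀ p → T (all2 p) → ∀ b → T (p b)
all2-sound p t false = proj₁ (Equivalence.to Bool.T-∧ t)
all2-sound p t true  = proj₂ (Equivalence.to Bool.T-∧ t)

check16 : (f g : Bool → Bool → Bool → Bool → ℕ) →
  T (all2 λ a → all2 λ b → all2 λ c → all2 λ d → f a b c d ≤ᵇ g a b c d) →
  ∀ a b c d → f a b c d ≤ g a b c d
check16 f g t a b c d =
  ≤ᵇ⇒≤ _ _ (all2-sound (λ d → f a b c d ≤ᵇ g a b c d)
    (all2-sound (λ c → all2 λ d → f a b c d ≤ᵇ g a b c d)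
      (all2-sound (λ b → all2 λ c → all2 λ d → f a b c d ≤ᵇ g a b c d)
        (all2-sound (λ a → all2 λ b → all2 λ c → all2 λ d → f a b c d ≤ᵇ g a b c d) t a) b) c) d)

sum-mono : ∀ {n} {f g : Fin n → ℕ} → (∀ i → f i ≤ g i) → sum f ≤ sum g
sum-mono {zero}  p = z≤n
sum-mono {suc n} p = +-mono-≤ (p zero) (sum-mono (p ∘ suc))

sum-zero : ∀ {n} {f : Fin n → ℕ} → (∀ i → f i ≡ 0) → sum f ≡ 0
sum-zero {n} p = trans (sum-cong-≗ p) (sum-replicate-zero n)

sum-δ : ∀ {n} (u : Fin n) (K : ℕ) → sum (λ v → if does (v ≟ᶠ u) then K else 0) ≡ K
sum-δ {suc n} zero    K = trans (cong (K +_) (sum-zero {n} λ _ → refl)) (+-identityʳ K)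
sum-δ {suc n} (suc u) K = sum-δ u K

sum-≤1 : ∀ {n} (f : Fin n → ℕ) → (∀ i → f i ≤ 1) →
  (∀ i j → 1 ≤ f i → 1 ≤ f j → i ≡ j) → sum f ≤ 1
sum-≤1 {zero}  f ≤1 once = z≤n
sum-≤1 {suc n} f ≤1 once with f zero in eq
... | zero  = sum-≤1 (f ∘ suc) (≤1 ∘ suc) λ i j p q → suc-injectiveᶠ (once (suc i) (suc j) p q)
... | suc k = begin
  suc k + sum (f ∘ suc) ≡⟨ cong (suc k +_) rest-zero ⟩
  suc k + 0             ≡⟨ +-identityʳ (suc k) ⟩
  suc k                 ≡⟨ eq ⟨
  f zero                ≤⟨ ≤1 zero ⟩
  1                     ∎
  where
  open ≤-Reasoning
  rest-zero : sum (f ∘ suc) ≡ 0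
  rest-zero = sum-zero nothing-else
    where
    nothing-else : ∀ i → f (suc i) ≡ 0
    nothing-else i with f (suc i) in eq′
    ... | zero  = refl
    ... | suc _ with once zero (suc i) (subst (1 ≤_) (sym eq) (s≤s z≤n)) (subst (1 ≤_) (sym eq′) (s≤s z≤n))
    ...   | ()

∣p∣≡sum : ∀ {n} (p : Subset n) → ∣ p ∣ ≡ sum (λ i → bit (does (i ∈? p)))
∣p∣≡sum []            = refl
∣p∣≡sum (inside  ∷ p) = cong suc (∣p∣≡sum p)
∣p∣≡sum (outside ∷ p) = ∣p∣≡sum p

∑□ : ∀ n → (Vec Bool n → ℕ) → ℕ
∑□ zero    f = f []
∑□ (suc n) f = ∑□ n (λ X → f (false ∷ X)) + ∑□ n (λ X → f (true ∷ X))

∑□-cong : ∀ n {f g : Vec Bool n → ℕ} → (∀ X → f X ≡ g X) → ∑□ n f ≡ ∑□ n g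
∑□-cong zero    p = p []
∑□-cong (suc n) p = cong₂ _+_ (∑□-cong n (p ∘ (false ∷_))) (∑□-cong n (p ∘ (true ∷_)))

∑□-mono : ∀ n {f g : Vec Bool n → ℕ} → (∀ X → f X ≤ g X) → ∑□ n f ≤ ∑□ n g
∑□-mono zero    p = p []
∑□-mono (suc n) p = +-mono-≤ (∑□-mono n (p ∘ (false ∷_))) (∑□-mono n (p ∘ (true ∷_)))

∑□-zero : ∀ n → ∑□ n (λ _ → 0) ≡ 0
∑□-zero zero    = refl
∑□-zero (suc n) = cong₂ _+_ (∑□-zero n) (∑□-zero n)

∑□-distrib-+ : ∀ n (f g : Vec Bool n → ℕ) → ∑□ n (λ X → f X + g X) ≡ ∑□ n f + ∑□ n g
∑□-distrib-+ zero    f g = refl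
∑□-distrib-+ (suc n) f g = trans
  (cong₂ _+_ (∑□-distrib-+ n (f ∘ (false ∷_)) (g ∘ (false ∷_)))
             (∑□-distrib-+ n (f ∘ (true ∷_)) (g ∘ (true ∷_))))
  (interchange (∑□ n (f ∘ (false ∷_))) (∑□ n (g ∘ (false ∷_)))
               (∑□ n (f ∘ (true ∷_))) (∑□ n (g ∘ (true ∷_))))

∑□-double : ∀ n (f : Vec Bool n → ℕ) → ∑□ n (λ X → 2 * f X) ≡ 2 * ∑□ n f
∑□-double n f = begin
  ∑□ n (λ X → f X + (f X + 0)) ≡⟨ ∑□-cong n (λ X → cong (f X +_) (+-identityʳ (f X))) ⟩
  ∑□ n (λ X → f X + f X)       ≡⟨ ∑□-distrib-+ n f f ⟩
  ∑□ n f + ∑□ n f              ≡⟨ cong (∑□ n f +_) (+-identityʳ (∑□ n f)) ⟨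
  ∑□ n f + (∑□ n f + 0)        ∎
  where open ≡-Reasoning

∑□-pos : ∀ n (f : Vec Bool n → ℕ) → 1 ≤ ∑□ n f → ∃[ X ] (1 ≤ f X)
∑□-pos zero    f p = [] , p
∑□-pos (suc n) f p with ∑□ n (f ∘ (false ∷_)) in eq
... | zero  = let X , q = ∑□-pos n (f ∘ (true ∷_)) p in true ∷ X , q
... | suc _ = let X , q = ∑□-pos n (f ∘ (false ∷_)) (subst (1 ≤_) (sym eq) (s≤s z≤n)) in false ∷ X , q

_≟ᵛ_ : ∀ {n} → DecidableEquality (Vec Bool n)
_≟ᵛ_ = ≡-dec Bool._≟_

count : ∀ {n} → (Vec Bool n → Bool) → ℕ
count {n} F = ∑□ n (λ X → bit (F X))

count-mono : ∀ {n} {F G : Vec Bool n → Bool} → (∀ X → F X ≡ true → G X ≡ true) → count F ≤ count G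
count-mono {n} {F} {G} F⊆G = ∑□-mono n pointwise
  where
  pointwise : ∀ X → bit (F X) ≤ bit (G X)
  pointwise X with F X in eq
  ... | true  = ≤-reflexive (cong bit (sym (F⊆G X eq)))
  ... | false = z≤n

count-point : ∀ {n} (P : Vec Bool n) → count (λ X → does (X ≟ᵛ P)) ≡ 1
count-point []              = refl
count-point {suc n} (false ∷ P) = cong₂ _+_ (count-point P) (∑□-zero n)
count-point {suc n} (true  ∷ P) = cong₂ _+_ (∑□-zero n) (count-point P)

count-insert : ∀ {n} (F : Vec Bool n → Bool) (P : Vec Bool n) → F P ≡ false →
  count (λ X → does (X ≟ᵛ P) ∨ F X) ≡ suc (count F)
count-insert {n} F P P∉F =
  trans (∑□-cong n pointwise) (trans (∑□-distrib-+ n _ _) (cong (_+ count F) (count-point P)))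
  where
  pointwise : ∀ X → bit (does (X ≟ᵛ P) ∨ F X) ≡ bit (does (X ≟ᵛ P)) + bit (F X)
  pointwise X with X ≟ᵛ P
  ... | yes refl = cong (λ b → 1 + bit b) (sym P∉F)
  ... | no _     = refl

count-members : ∀ {n} (F : Vec Bool n → Bool) (Ps : List (Vec Bool n)) →
  AllPairs _≢_ Ps → All (λ P → F P ≡ true) Ps → length Ps ≤ count F
count-members F []       _            _          = z≤n
count-members {n} F (P ∷ Ps) (P≢Ps ∷ distinct) (P∈F ∷ Ps∈F) = begin
  suc (length Ps)                      ≤⟨ s≤s (count-members F′ Ps distinct (All.zipWith in-F′ (P≢Ps , Ps∈F))) ⟩
  suc (count F′)                       ≡⟨ count-insert F′ P P∉F′ ⟨
  count (λ X → does (X ≟ᵛ P) ∨ F′ X)   ≡⟨ ∑□-cong n (λ X → cong bit (split X)) ⟩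
  count F                              ∎
  where
  open ≤-Reasoning
  F′ : Vec Bool n → Bool
  F′ X = F X ∧ not (does (X ≟ᵛ P))
  P∉F′ : F′ P ≡ false
  P∉F′ with P ≟ᵛ P
  ... | yes _  = Bool.∧-zeroʳ (F P)
  ... | no P≢P = contradiction refl P≢P
  in-F′ : ∀ {Q} → P ≢ Q × F Q ≡ true → F′ Q ≡ true
  in-F′ {Q} (P≢Q , Q∈F) with Q ≟ᵛ P
  ... | yes Q≡P = contradiction (sym Q≡P) P≢Q
  ... | no _    = trans (Bool.∧-identityʳ (F Q)) Q∈F
  split : ∀ X → does (X ≟ᵛ P) ∨ F′ X ≡ F X
  split X with X ≟ᵛ P
  ... | yes refl = sym P∈F
  ... | no _     = Bool.∧-identityʳ (F X)

count-⊆ : ∀ {n} (A : Subset n) → count (λ X → does (X ⊆? A)) ≡ 2 ^ ∣ A ∣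
count-⊆ []                    = refl
count-⊆ {suc n} (outside ∷ A) = trans (cong₂ _+_ (count-⊆ A) (∑□-zero n)) (+-identityʳ _)
count-⊆ {suc n} (inside  ∷ A) =
  trans (cong₂ _+_ (count-⊆ A) (count-⊆ A)) (cong (2 ^ ∣ A ∣ +_) (sym (+-identityʳ _)))

image : ∀ {m n} → Subset m → (Fin m → Vec Bool n) → Vec Bool n → Bool
image []      t X = false
image (s ∷ P) t X = (s ∧ does (X ≟ᵛ t zero)) ∨ image P (t ∘ suc) X

image-intro : ∀ {m n} (P : Subset m) (t : Fin m → Vec Bool n) {x} → x ∈ P → image P t (t x) ≡ true
image-intro (inside ∷ P) t here with t zero ≟ᵛ t zero
... | yes _   = refl
... | no t≢t  = contradiction refl t≢t
image-intro (s ∷ P) t (there x∈P) =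
  trans (cong (_ ∨_) (image-intro P (t ∘ suc) x∈P)) (Bool.∨-zeroʳ _)

image-elim : ∀ {m n} (P : Subset m) (t : Fin m → Vec Bool n) X → image P t X ≡ true →
  ∃[ x ] (x ∈ P × X ≡ t x)
image-elim (inside ∷ P) t X X∈ with X ≟ᵛ t zero
... | yes X≡t₀ = zero , here , X≡t₀
... | no _     = let x , x∈P , X≡tx = image-elim P (t ∘ suc) X X∈ in suc x , there x∈P , X≡tx
image-elim (outside ∷ P) t X X∈ =
  let x , x∈P , X≡tx = image-elim P (t ∘ suc) X X∈ in suc x , there x∈P , X≡tx

count-image : ∀ {m n} (P : Subset m) (t : Fin m → Vec Bool n) →
  (∀ {x y} → x ∈ P → y ∈ P → t x ≡ t y → x ≡ y) → count (image P t) ≡ ∣ P ∣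
count-image {n = n} []  t inj = ∑□-zero n
count-image (outside ∷ P) t inj =
  count-image P (t ∘ suc) λ x∈P y∈P eq → suc-injectiveᶠ (inj (there x∈P) (there y∈P) eq)
count-image (inside ∷ P) t inj =
  trans (count-insert (image P (t ∘ suc)) (t zero) fresh)
        (cong suc (count-image P (t ∘ suc) λ x∈P y∈P eq → suc-injectiveᶠ (inj (there x∈P) (there y∈P) eq)))
  where
  fresh : image P (t ∘ suc) (t zero) ≡ false
  fresh with image P (t ∘ suc) (t zero) in t₀∈
  ... | false = refl
  ... | true with image-elim P (t ∘ suc) (t zero) t₀∈
  ...   | x , x∈P , t₀≡ with inj here (there x∈P) t₀≡
  ...     | ()

unless : Bool → ℕ → ℕ
unless b m = if b then 0 else m

unless-bit : ∀ b c → bit (not b ∧ c) ≡ unless b (bit c)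
unless-bit true  c = refl
unless-bit false c = refl

unless-+ : ∀ b m k → unless b (m + k) ≡ unless b m + unless b k
unless-+ true  m k = refl
unless-+ false m k = refl

unless-double : ∀ b m → unless b (2 * m) ≡ 2 * unless b m
unless-double true  m = refl
unless-double false m = refl

unless-mono : ∀ b {m k} → m ≤ k → unless b m ≤ unless b k
unless-mono true  _   = z≤n
unless-mono false m≤k = m≤k

unless-comm : ∀ a b m → unless a (unless b m) ≡ unless b (unless a m)
unless-comm true  true  m = refl
unless-comm true  false m = refl
unless-comm false true  m = refl
unless-comm false false m = refl

unless-pos : ∀ x y c → 1 ≤ unless x (unless y (bit c)) → x ≡ false × y ≡ false × c ≡ true
unless-pos false false true _ = refl , refl , refl

∧-true : ∀ a {b} → a ∧ b ≡ true → a ≡ true × b ≡ true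
∧-true true {true} _ = refl , refl

flip : ∀ {n} → Fin n → Vec Bool n → Vec Bool n
flip u X = updateAt X u not

flip-same : ∀ {n} (u : Fin n) X → lookup (flip u X) u ≡ not (lookup X u)
flip-same u X = lookup∘updateAt u X

flip-other : ∀ {n} {u v : Fin n} X → u ≢ v → lookup (flip u X) v ≡ lookup X v
flip-other X u≢v = lookup∘updateAt′ _ _ (u≢v ∘ sym) X

flip-comm : ∀ {n} {u v : Fin n} X → u ≢ v → flip u (flip v X) ≡ flip v (flip u X)
flip-comm X u≢v = updateAt-commutes _ _ u≢v X

differ-at : ∀ {n} {X Y : Vec Bool n} i → lookup X i ≡ not (lookup Y i) → X ≢ Y
differ-at i Xi≡¬Yi refl = Bool.not-¬ refl Xi≡¬Yi

flip-moves : ∀ {n} (u : Fin n) X → flip u X ≢ X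
flip-moves u X = differ-at u (flip-same u X)

flip-distinct : ∀ {n} {u v : Fin n} X → u ≢ v → flip u X ≢ flip v X
flip-distinct {u = u} X u≢v =
  differ-at u (trans (flip-same u X) (cong not (sym (flip-other X (u≢v ∘ sym)))))

flip₂-moves : ∀ {n} {u v : Fin n} X → u ≢ v → flip u (flip v X) ≢ X
flip₂-moves {v = v} X u≢v = differ-at v (trans (flip-other (flip v X) u≢v) (flip-same v X))

vec-ext : ∀ {n} {X Y : Vec Bool n} → (∀ i → lookup X i ≡ lookup Y i) → X ≡ Y
vec-ext {X = X} {Y} same = trans (sym (tabulate∘lookup X)) (trans (tabulate-cong same) (tabulate∘lookup Y))

∑□-pair : ∀ n (u : Fin n) (f : Vec Bool n → ℕ) →
  ∑□ n f ≡ ∑□ n (λ X → unless (lookup X u) (f X + f (flip u X)))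
∑□-pair (suc n) zero f = sym (begin
  ∑□ n pairs + ∑□ n (λ _ → 0)  ≡⟨ cong (∑□ n pairs +_) (∑□-zero n) ⟩
  ∑□ n pairs + 0               ≡⟨ +-identityʳ _ ⟩
  ∑□ n pairs                   ≡⟨ ∑□-distrib-+ n _ _ ⟩
  ∑□ (suc n) f                 ∎)
  where
  open ≡-Reasoning
  pairs : Vec Bool n → ℕ
  pairs X = f (false ∷ X) + f (true ∷ X)
∑□-pair (suc n) (suc u) f =
  cong₂ _+_ (∑□-pair n u (f ∘ (false ∷_))) (∑□-pair n u (f ∘ (true ∷_)))

-- For a
-- square with corners a = X, b = flip u X, c = flip v X, d = flip u (flip v X),
-- they compare its v-edges {a,c}, {b,d} with the v-edge of its contraction
-- along u and with the square itself.
corner-edges≤contracted+square : ∀ a b c d →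
  bit (a ∧ c) + bit (b ∧ d) ≤ bit ((a ∨ b) ∧ (c ∨ d)) + bit (a ∧ (b ∧ (c ∧ d)))
corner-edges≤contracted+square = check16
  (λ a b c d → bit (a ∧ c) + bit (b ∧ d))
  (λ a b c d → bit ((a ∨ b) ∧ (c ∨ d)) + bit (a ∧ (b ∧ (c ∧ d)))) _

corner-edges≤2contracted : ∀ a b c d → bit (a ∧ c) + bit (b ∧ d) ≤ 2 * bit ((a ∨ b) ∧ (c ∨ d))
corner-edges≤2contracted = check16
  (λ a b c d → bit (a ∧ c) + bit (b ∧ d))
  (λ a b c d → 2 * bit ((a ∨ b) ∧ (c ∨ d))) _

corner-2square≤edges : ∀ a b c d → 2 * bit (a ∧ (b ∧ (c ∧ d))) ≤ bit (a ∧ b) + bit (c ∧ d)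
corner-2square≤edges = check16
  (λ a b c d → 2 * bit (a ∧ (b ∧ (c ∧ d))))
  (λ a b c d → bit (a ∧ b) + bit (c ∧ d)) _

weight : ℕ → ℕ
weight zero          = 0
weight (suc zero)    = 2
weight (suc (suc _)) = 3

weight-mono : ∀ {e e′} → e ≤ e′ → weight e ≤ weight e′
weight-mono {zero}                z≤n                = z≤n
weight-mono {suc zero}    {suc zero}    _            = ≤-refl
weight-mono {suc zero}    {suc (suc _)} _            = s≤s (s≤s z≤n)
weight-mono {suc (suc _)} {suc zero}    (s≤s ())
weight-mono {suc (suc _)} {suc (suc _)} _            = ≤-refl

loss-none : ∀ {e e′} → e ≤ e′ → weight e ∸ weight e′ ≡ 0
loss-none e≤e′ = m≤n⇒m∸n≡0 (weight-mono e≤e′)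

loss-halved : ∀ e e′ → e ≤ 2 * e′ → weight e ∸ weight e′ ≤ 1
loss-halved zero                e′            _ = ≤-trans (≤-reflexive (0∸n≡0 (weight e′))) z≤n
loss-halved (suc zero)          (suc zero)    _ = z≤n
loss-halved (suc zero)          (suc (suc _)) _ = z≤n
loss-halved (suc (suc e))       (suc zero)    _ = s≤s z≤n
loss-halved (suc (suc e))       (suc (suc _)) _ = z≤n

loss-halved-large : ∀ e e′ → 3 ≤ e → e ≤ 2 * e′ → weight e ∸ weight e′ ≡ 0
loss-halved-large (suc (suc (suc e))) (suc (suc _)) _               _              = refl
loss-halved-large (suc (suc (suc e))) (suc zero)    _               (s≤s (s≤s ()))
loss-halved-large (suc (suc (suc e))) zero          _               ()
loss-halved-large (suc (suc zero))    _             (s≤s (s≤s ()))  _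
loss-halved-large (suc zero)          _             (s≤s ())        _
loss-halved-large zero                _             ()              _

weight≤2* : ∀ {e} → 1 ≤ e → weight e ≤ 2 * e
weight≤2* {suc zero}    _ = ≤-refl
weight≤2* {suc (suc e)} _ = s≤s (s≤s (≤-trans (s≤s z≤n) (m≤n+m _ e)))

2*≤1⇒≡0 : ∀ {s} → 2 * s ≤ 1 → s ≡ 0
2*≤1⇒≡0 {s} 2s≤1 = n≤0⇒n≡0 (≤-pred (*-cancelˡ-< 2 s 1 (s≤s 2s≤1)))

module Families {n : ℕ} where

  Family : Set
  Family = Vec Bool n → Bool

  -- An edge of F in direction u, recorded at its endpoint X with X u = false.
  edge : Family → Fin n → Vec Bool n → Bool
  edge F u X = not (lookup X u) ∧ (F X ∧ F (flip u X))

  edges : Family → Fin n → ℕ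
  edges F u = count (edge F u)

  -- Contracting direction u identifies X with flip u X.
  contract : Family → Fin n → Family
  contract F u X = not (lookup X u) ∧ (F X ∨ F (flip u X))

  onFaces : Fin n → Fin n → (Vec Bool n → ℕ) → ℕ
  onFaces u v h = ∑□ n (λ X → unless (lookup X u) (unless (lookup X v) (h X)))

  squares : Family → Fin n → Fin n → ℕ
  squares F u v = onFaces u v (λ X → bit (F X ∧ (F (flip u X) ∧ (F (flip v X) ∧ F (flip u (flip v X))))))

  onFaces-mono : ∀ u v {h k} → (∀ X → h X ≤ k X) → onFaces u v h ≤ onFaces u v k
  onFaces-mono u v h≤k = ∑□-mono n λ X → unless-mono (lookup X u) (unless-mono (lookup X v) (h≤k X))

  onFaces-+ : ∀ u v h k → onFaces u v (λ X → h X + k X) ≡ onFaces u v h + onFaces u v k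
  onFaces-+ u v h k = trans
    (∑□-cong n λ X → trans (cong (unless (lookup X u)) (unless-+ (lookup X v) (h X) (k X)))
                           (unless-+ (lookup X u) _ _))
    (∑□-distrib-+ n _ _)

  onFaces-double : ∀ u v h → onFaces u v (λ X → 2 * h X) ≡ 2 * onFaces u v h
  onFaces-double u v h = trans
    (∑□-cong n λ X → trans (cong (unless (lookup X u)) (unless-double (lookup X v) (h X)))
                           (unless-double (lookup X u) _))
    (∑□-double n _)

  onFaces-sym : ∀ u v h → onFaces u v h ≡ onFaces v u h
  onFaces-sym u v h = ∑□-cong n λ X → unless-comm (lookup X u) (lookup X v) (h X)

  count-contract : ∀ F u → count (contract F u) + edges F u ≡ count F
  count-contract F u = begin
    count (contract F u) + edges F u
      ≡⟨ ∑□-distrib-+ n _ _ ⟨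
    ∑□ n (λ X → bit (contract F u X) + bit (edge F u X))
      ≡⟨ ∑□-cong n (λ X → pair (lookup X u) (F X) (F (flip u X))) ⟩
    ∑□ n (λ X → unless (lookup X u) (bit (F X) + bit (F (flip u X))))
      ≡⟨ ∑□-pair n u _ ⟨
    count F ∎
    where
    open ≡-Reasoning
    pair : ∀ x a b → bit (not x ∧ (a ∨ b)) + bit (not x ∧ (a ∧ b)) ≡ unless x (bit a + bit b)
    pair true  a b = refl
    pair false a b = bit-∨-∧ a b

  -- Each u-edge leaves a point of the contraction.
  edges≤count-contract : ∀ F u → edges F u ≤ count (contract F u)
  edges≤count-contract F u = ∑□-mono n λ X → ∧≤∨ (lookup X u) (F X) (F (flip u X))
    where
    ∧≤∨ : ∀ x a b → bit (not x ∧ (a ∧ b)) ≤ bit (not x ∧ (a ∨ b))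
    ∧≤∨ true  a b = z≤n
    ∧≤∨ false a b = bit-∧≤∨ a b

  edges-on-faces : ∀ F {u v} → u ≢ v → edges F v ≡
    onFaces u v (λ X → bit (F X ∧ F (flip v X)) + bit (F (flip u X) ∧ F (flip u (flip v X))))
  edges-on-faces F {u} {v} u≢v =
    trans (∑□-pair n u _) (∑□-cong n λ X → cong (unless (lookup X u)) (face X))
    where
    open ≡-Reasoning
    face : ∀ X → bit (edge F v X) + bit (edge F v (flip u X)) ≡
      unless (lookup X v) (bit (F X ∧ F (flip v X)) + bit (F (flip u X) ∧ F (flip u (flip v X))))
    face X = begin
      bit (edge F v X) + bit (edge F v (flip u X))
        ≡⟨ cong₂ (λ y Y → bit (edge F v X) + bit (not y ∧ (F (flip u X) ∧ F Y)))
                 (flip-other X u≢v) (flip-comm X (u≢v ∘ sym)) ⟩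
      bit (not (lookup X v) ∧ (F X ∧ F (flip v X)))
        + bit (not (lookup X v) ∧ (F (flip u X) ∧ F (flip u (flip v X))))
        ≡⟨ cong₂ _+_ (unless-bit (lookup X v) _) (unless-bit (lookup X v) _) ⟩
      unless (lookup X v) (bit (F X ∧ F (flip v X)))
        + unless (lookup X v) (bit (F (flip u X) ∧ F (flip u (flip v X))))
        ≡⟨ unless-+ (lookup X v) _ _ ⟨
      unless (lookup X v) (bit (F X ∧ F (flip v X)) + bit (F (flip u X) ∧ F (flip u (flip v X)))) ∎

  edges-on-faces′ : ∀ F {u v} → u ≢ v → edges F u ≡
    onFaces u v (λ X → bit (F X ∧ F (flip u X)) + bit (F (flip v X) ∧ F (flip u (flip v X))))
  edges-on-faces′ F {u} {v} u≢v = begin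
    edges F u
      ≡⟨ edges-on-faces F (u≢v ∘ sym) ⟩
    onFaces v u (λ X → bit (F X ∧ F (flip u X)) + bit (F (flip v X) ∧ F (flip v (flip u X))))
      ≡⟨ onFaces-sym v u _ ⟩
    onFaces u v (λ X → bit (F X ∧ F (flip u X)) + bit (F (flip v X) ∧ F (flip v (flip u X))))
      ≡⟨ ∑□-cong n (λ X → cong (λ Y → unless (lookup X u) (unless (lookup X v)
           (bit (F X ∧ F (flip u X)) + bit (F (flip v X) ∧ F Y)))) (flip-comm X (u≢v ∘ sym))) ⟩
    onFaces u v (λ X → bit (F X ∧ F (flip u X)) + bit (F (flip v X) ∧ F (flip u (flip v X)))) ∎
    where open ≡-Reasoning

  contract-edges-on-faces : ∀ F {u v} → u ≢ v → edges (contract F u) v ≡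
    onFaces u v (λ X → bit ((F X ∨ F (flip u X)) ∧ (F (flip v X) ∨ F (flip u (flip v X)))))
  contract-edges-on-faces F {u} {v} u≢v = ∑□-cong n λ X →
    trans (cong (λ y → bit (not (lookup X v) ∧ (contract F u X ∧ (not y ∧ (F (flip v X) ∨ F (flip u (flip v X)))))))
                (flip-other X (u≢v ∘ sym)))
          (face (lookup X u) (lookup X v) _ _)
    where
    face : ∀ x y a b → bit (not y ∧ ((not x ∧ a) ∧ (not x ∧ b))) ≡ unless x (unless y (bit (a ∧ b)))
    face true  true  a b = refl
    face true  false a b = refl
    face false true  a b = refl
    face false false a b = refl

  -- The three estimates relating u,v-squares to edges (for u ≢ v): a v-edge
  -- survives contraction along u unless it lies in a square; contraction along u
  -- at most halves the v-edges; a square contributes two u-edges.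
  edges≤contract+squares : ∀ F {u v} → u ≢ v → edges F v ≤ edges (contract F u) v + squares F u v
  edges≤contract+squares F {u} {v} u≢v =
    subst₂ _≤_ (sym (edges-on-faces F u≢v))
      (trans (onFaces-+ u v _ _) (cong (_+ squares F u v) (sym (contract-edges-on-faces F u≢v))))
      (onFaces-mono u v λ X →
        corner-edges≤contracted+square (F X) (F (flip u X)) (F (flip v X)) (F (flip u (flip v X))))

  edges≤2contract : ∀ F {u v} → u ≢ v → edges F v ≤ 2 * edges (contract F u) v
  edges≤2contract F {u} {v} u≢v =
    subst₂ _≤_ (sym (edges-on-faces F u≢v))
      (trans (onFaces-double u v _) (cong (2 *_) (sym (contract-edges-on-faces F u≢v))))
      (onFaces-mono u v λ X →
        corner-edges≤2contracted (F X) (F (flip u X)) (F (flip v X)) (F (flip u (flip v X))))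

  2squares≤edges : ∀ F {u v} → u ≢ v → 2 * squares F u v ≤ edges F u
  2squares≤edges F {u} {v} u≢v =
    subst₂ _≤_ (onFaces-double u v _) (sym (edges-on-faces′ F u≢v))
      (onFaces-mono u v λ X →
        corner-2square≤edges (F X) (F (flip u X)) (F (flip v X)) (F (flip u (flip v X))))

  square-edges : ∀ F {u v} → u ≢ v → 1 ≤ squares F u v →
    ∃[ X ] (edge F u X ≡ true × edge F u (flip v X) ≡ true)
  square-edges F {u} {v} u≢v p =
    let X , corner            = ∑□-pos n _ p
        Xu≡false , _ , all∈F  = unless-pos (lookup X u) (lookup X v) _ corner
        a , bcd               = ∧-true (F X) all∈F
        b , cd                = ∧-true (F (flip u X)) bcd
        c , d                 = ∧-true (F (flip v X)) cd
    in X , cong₂ (λ y z → not y ∧ z) Xu≡false (cong₂ _∧_ a b)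
         , cong₂ (λ y z → not y ∧ z) (trans (flip-other X (u≢v ∘ sym)) Xu≡false) (cong₂ _∧_ c d)

  two-squares⇒3≤edges : ∀ F {u v v′} → u ≢ v → u ≢ v′ → v ≢ v′ →
    1 ≤ squares F u v → 1 ≤ squares F u v′ → 3 ≤ edges F u
  two-squares⇒3≤edges F {u} {v} {v′} u≢v u≢v′ v≢v′ sq sq′
    with square-edges F u≢v sq | square-edges F u≢v′ sq′
  ... | X , eX , efX | Y , eY , efY with Y ≟ᵛ X | Y ≟ᵛ flip v X
  ... | yes refl | _ = count-members (edge F u) (X ∷ flip v X ∷ flip v′ X ∷ [])
          ((≢-sym (flip-moves v X) ∷ ≢-sym (flip-moves v′ X) ∷ []) ∷ (flip-distinct X v≢v′ ∷ []) ∷ [] ∷ [])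
          (eX ∷ efX ∷ efY ∷ [])
  ... | no _ | yes refl = count-members (edge F u) (X ∷ flip v X ∷ flip v′ (flip v X) ∷ [])
          ((≢-sym (flip-moves v X) ∷ ≢-sym (flip₂-moves X (v≢v′ ∘ sym)) ∷ [])
            ∷ (≢-sym (flip-moves v′ (flip v X)) ∷ []) ∷ [] ∷ [])
          (eX ∷ efX ∷ efY ∷ [])
  ... | no Y≢X | no Y≢fX = count-members (edge F u) (X ∷ flip v X ∷ Y ∷ [])
          ((≢-sym (flip-moves v X) ∷ ≢-sym Y≢X ∷ []) ∷ (≢-sym Y≢fX ∷ []) ∷ [] ∷ [])
          (eX ∷ efX ∷ eY ∷ [])

  Ω : Family → ℕ
  Ω F = sum (λ v → weight (edges F v))

  loss : Family → Fin n → Fin n → ℕ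
  loss F u v = if does (v ≟ᶠ u) then 0 else weight (edges F v) ∸ weight (edges (contract F u) v)

  Ω-contract : ∀ F u → Ω F ≤ Ω (contract F u) + weight (edges F u) + sum (loss F u)
  Ω-contract F u = begin
    Ω F                                                    ≤⟨ sum-mono pointwise ⟩
    sum (λ v → after v + at-u v + loss F u v)              ≡⟨ ∑-distrib-+ (λ v → after v + at-u v) (loss F u) ⟩
    sum (λ v → after v + at-u v) + sum (loss F u)          ≡⟨ cong (_+ sum (loss F u)) (∑-distrib-+ after at-u) ⟩
    Ω (contract F u) + sum at-u + sum (loss F u)           ≡⟨ cong (λ m → Ω (contract F u) + m + sum (loss F u)) (sum-δ u _) ⟩
    Ω (contract F u) + weight (edges F u) + sum (loss F u) ∎
    where
    open ≤-Reasoning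
    after : Fin n → ℕ
    after v = weight (edges (contract F u) v)
    at-u : Fin n → ℕ
    at-u v = if does (v ≟ᶠ u) then weight (edges F u) else 0
    pointwise : ∀ v → weight (edges F v) ≤ after v + at-u v + loss F u v
    pointwise v with v ≟ᶠ u
    ... | yes refl = ≤-trans (m≤n+m (weight (edges F v)) (after v)) (m≤m+n _ 0)
    ... | no _     = subst (λ m → weight (edges F v) ≤ m + (weight (edges F v) ∸ after v))
                       (sym (+-identityʳ (after v))) (m≤n+m∸n _ (after v))

  -- A direction u with a single edge lies in no square, so contracting it loses nothing elsewhere.
  loss-single : ∀ F u → edges F u ≡ 1 → ∀ v → loss F u v ≡ 0
  loss-single F u e≡1 v with v ≟ᶠ u
  ... | yes _  = refl
  ... | no v≢u = loss-none (begin
      edges F v                                ≤⟨ edges≤contract+squares F u≢v ⟩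
      edges (contract F u) v + squares F u v   ≡⟨ cong (edges (contract F u) v +_) no-squares ⟩
      edges (contract F u) v + 0               ≡⟨ +-identityʳ _ ⟩
      edges (contract F u) v                   ∎)
    where
    open ≤-Reasoning
    u≢v : u ≢ v
    u≢v = v≢u ∘ sym
    no-squares : squares F u v ≡ 0
    no-squares = 2*≤1⇒≡0 (≤-trans (2squares≤edges F u≢v) (≤-reflexive e≡1))

  loss⇒square : ∀ F u v → 1 ≤ loss F u v → u ≢ v × 1 ≤ squares F u v
  loss⇒square F u v pos with v ≟ᶠ u
  loss⇒square F u v () | yes _
  ... | no v≢u with squares F u v in sq | edges≤contract+squares F {u} {v} (v≢u ∘ sym)
  ...   | suc _ | _ = v≢u ∘ sym , s≤s z≤n
  ...   | zero  | e≤e′+0 with subst (1 ≤_) (loss-none (subst (_ ≤_) (+-identityʳ _) e≤e′+0)) pos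
  ...     | ()

  -- With two edges at u the loss elsewhere is at most 1: each loss is at most 1
  -- since contraction at most halves edge counts, and squares in two directions
  -- would give three u-edges.
  loss-double : ∀ F u → edges F u ≡ 2 → sum (loss F u) ≤ 1
  loss-double F u e≡2 = sum-≤1 (loss F u) at-most-1 only-one
    where
    at-most-1 : ∀ v → loss F u v ≤ 1
    at-most-1 v with v ≟ᶠ u
    ... | yes _  = z≤n
    ... | no v≢u = loss-halved (edges F v) (edges (contract F u) v) (edges≤2contract F (v≢u ∘ sym))
    only-one : ∀ v w → 1 ≤ loss F u v → 1 ≤ loss F u w → v ≡ w
    only-one v w pos pos′ with v ≟ᶠ w | loss⇒square F u v pos | loss⇒square F u w pos′
    ... | yes v≡w | _ | _ = v≡w
    ... | no v≢w | u≢v , sq | u≢w , sq′ =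
      contradiction (subst (3 ≤_) e≡2 (two-squares⇒3≤edges F u≢v u≢w v≢w sq sq′)) λ { (s≤s (s≤s ())) }

  -- If no direction has one or two edges, contraction loses nothing elsewhere:
  -- counts ≥ 3 stay ≥ 2 after halving.
  loss-large : ∀ F u → (∀ v → edges F v ≢ 1) → (∀ v → edges F v ≢ 2) → ∀ v → loss F u v ≡ 0
  loss-large F u ≢1 ≢2 v with v ≟ᶠ u
  ... | yes _  = refl
  ... | no v≢u with edges F v in e | edges≤2contract F {u} {v} (v≢u ∘ sym)
  ...   | zero                | _     = 0∸n≡0 (weight (edges (contract F u) v))
  ...   | suc zero            | _     = contradiction e (≢1 v)
  ...   | suc (suc zero)      | _     = contradiction e (≢2 v)
  ...   | suc (suc (suc _))   | e≤2e′ = loss-halved-large _ (edges (contract F u) v) (s≤s (s≤s (s≤s z≤n))) e≤2e′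

  lossless-budget : ∀ F u → 1 ≤ edges F u → (∀ v → loss F u v ≡ 0) →
    weight (edges F u) + sum (loss F u) ≤ 2 * edges F u
  lossless-budget F u e≥1 no-loss = begin
    weight (edges F u) + sum (loss F u) ≡⟨ cong (weight (edges F u) +_) (sum-zero no-loss) ⟩
    weight (edges F u) + 0              ≡⟨ +-identityʳ _ ⟩
    weight (edges F u)                  ≤⟨ weight≤2* e≥1 ⟩
    2 * edges F u                       ∎
    where open ≤-Reasoning

  double-budget : ∀ F u → edges F u ≡ 2 → weight (edges F u) + sum (loss F u) ≤ 2 * edges F u
  double-budget F u e≡2 = begin
    weight (edges F u) + sum (loss F u) ≡⟨ cong (λ e → weight e + sum (loss F u)) e≡2 ⟩
    3 + sum (loss F u)                  ≤⟨ +-monoʳ-≤ 3 (loss-double F u e≡2) ⟩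
    4                                   ≡⟨ cong (2 *_) e≡2 ⟨
    2 * edges F u                       ∎
    where open ≤-Reasoning

  contraction-step : ∀ N F u → count F ≤ suc N → 1 ≤ edges F u →
    weight (edges F u) + sum (loss F u) ≤ 2 * edges F u →
    (∀ F′ → count F′ ≤ N → 1 ≤ count F′ → 2 + Ω F′ ≤ 2 * count F′) →
    2 + Ω F ≤ 2 * count F
  contraction-step N F u count≤ e≥1 budget ih = begin
    2 + Ω F                                      ≤⟨ +-monoʳ-≤ 2 (Ω-contract F u) ⟩
    2 + (Ω F′ + weight e + sum (loss F u))       ≡⟨ cong (2 +_) (+-assoc (Ω F′) (weight e) _) ⟩
    2 + (Ω F′ + (weight e + sum (loss F u)))     ≡⟨ +-assoc 2 (Ω F′) _ ⟨
    2 + Ω F′ + (weight e + sum (loss F u))       ≤⟨ +-mono-≤ (ih F′ smaller nonempty) budget ⟩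
    2 * count F′ + 2 * e                         ≡⟨ *-distribˡ-+ 2 (count F′) e ⟨
    2 * (count F′ + e)                           ≡⟨ cong (2 *_) (count-contract F u) ⟩
    2 * count F                                  ∎
    where
    open ≤-Reasoning
    F′ : Family
    F′ = contract F u
    e : ℕ
    e = edges F u
    nonempty : 1 ≤ count F′
    nonempty = ≤-trans e≥1 (edges≤count-contract F u)
    smaller : count F′ ≤ N
    smaller = ≤-pred (begin
      suc (count F′)  ≡⟨ +-comm 1 (count F′) ⟩
      count F′ + 1    ≤⟨ +-monoʳ-≤ (count F′) e≥1 ⟩
      count F′ + e    ≡⟨ count-contract F u ⟩
      count F         ≤⟨ count≤ ⟩
      suc N           ∎)

  -- Contract a direction with one edge if there is one, else one with two edges,
  -- else any direction with edges; with no edges at all Ω F = 0.  The induction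
  -- is on a bound N for count F, which contraction decreases.
  weight-bound : ∀ N F → count F ≤ N → 1 ≤ count F → 2 + Ω F ≤ 2 * count F
  weight-bound zero    F count≤ nonempty = contradiction (≤-trans nonempty count≤) λ ()
  weight-bound (suc N) F count≤ nonempty with any? (λ u → edges F u ≟ 1)
  ... | yes (u , e≡1) = contraction-step N F u count≤ (≤-reflexive (sym e≡1))
                          (lossless-budget F u (≤-reflexive (sym e≡1)) (loss-single F u e≡1)) (weight-bound N)
  ... | no  ≢1 with any? (λ u → edges F u ≟ 2)
  ...   | yes (u , e≡2) = contraction-step N F u count≤ (≤-trans (s≤s z≤n) (≤-reflexive (sym e≡2)))
                            (double-budget F u e≡2) (weight-bound N)
  ...   | no  ≢2 with any? (λ u → 1 ≤? edges F u)
  ...     | yes (u , e≥1) = contraction-step N F u count≤ e≥1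
                              (lossless-budget F u e≥1 (loss-large F u (λ v e → ≢1 (v , e)) (λ v e → ≢2 (v , e))))
                              (weight-bound N)
  ...     | no  no-edges = begin
    2 + Ω F     ≡⟨ cong (2 +_) (sum-zero λ v → cong weight (n≤0⇒n≡0 (≮⇒≥ λ e≥1 → no-edges (v , e≥1)))) ⟩
    2 * 1       ≤⟨ *-monoʳ-≤ 2 nonempty ⟩
    2 * count F ∎
    where open ≤-Reasoning

  direction-bound : ∀ F (A : Subset n) → 1 ≤ count F → (∀ u → u ∈ A → 2 ≤ edges F u) →
    3 * ∣ A ∣ + 2 ≤ 2 * count F
  direction-bound F A nonempty two-edges = begin
    3 * ∣ A ∣ + 2                                ≡⟨ +-comm (3 * ∣ A ∣) 2 ⟩
    2 + 3 * ∣ A ∣                                ≡⟨ cong (λ m → 2 + 3 * m) (∣p∣≡sum A) ⟩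
    2 + 3 * sum (λ u → bit (does (u ∈? A)))      ≡⟨ cong (2 +_) (*-distribˡ-sum 3 (λ u → bit (does (u ∈? A)))) ⟩
    2 + sum (λ u → 3 * bit (does (u ∈? A)))      ≤⟨ +-monoʳ-≤ 2 (sum-mono pointwise) ⟩
    2 + Ω F                                      ≤⟨ weight-bound (count F) F ≤-refl nonempty ⟩
    2 * count F                                  ∎
    where
    open ≤-Reasoning
    pointwise : ∀ u → 3 * bit (does (u ∈? A)) ≤ weight (edges F u)
    pointwise u with u ∈? A
    ... | yes u∈A = weight-mono (two-edges u u∈A)
    ... | no  _   = z≤n

open Families

∉∈⇒≢ : ∀ {n} {p : Subset n} {x y} → x ∉ p → y ∈ p → x ≢ y
∉∈⇒≢ x∉p y∈p refl = x∉p y∈p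

adj-complement : ∀ {n} (G : Graph n) {x y} → x ≢ y → adj (complement G) x y ≡ not (adj G x y)
adj-complement G {x} {y} x≢y with x ≟ᶠ y
... | yes x≡y = contradiction x≡y x≢y
... | no  _   = Bool.∧-identityʳ _

complement-agree : ∀ {n} (G : Graph n) (S : Subset n) {x x′} → x ∉ S → x′ ∉ S →
  (∀ w → w ∈ S → adj (complement G) x w ≡ adj (complement G) x′ w) →
  ∀ w → w ∈ S → adj G x w ≡ adj G x′ w
complement-agree G S {x} {x′} x∉S x′∉S agree w w∈S = Bool.not-injective (begin
  not (adj G x w)          ≡⟨ adj-complement G (∉∈⇒≢ x∉S w∈S) ⟨
  adj (complement G) x w   ≡⟨ agree w w∈S ⟩
  adj (complement G) x′ w  ≡⟨ adj-complement G (∉∈⇒≢ x′∉S w∈S) ⟩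
  not (adj G x′ w)         ∎)
  where open ≡-Reasoning

-- If S is an LD-set of G but every LD-set of Ḡ is larger than S, then some vertex
-- outside S is adjacent to all of S: otherwise S itself would be an LD-set of Ḡ.
full-neighbour : ∀ {n} (G : Graph n) (S : Subset n) → IsLDSet G S →
  (∀ S′ → IsLDSet (complement G) S′ → suc ∣ S ∣ ≤ ∣ S′ ∣) →
  ∃[ v ] (v ∉ S × (∀ w → w ∈ S → v ∼[ G ] w))
full-neighbour G S (dominating , separating) larger
  with any? (λ v → ¬? (v ∈? S) ×-dec all? (λ w → w ∈? S →-dec adj G v w Bool.≟ true))
... | yes found = found
... | no  none  = contradiction (larger S (dominating′ , separating′)) (<-irrefl refl)
  where
  dominating′ : ∀ v → v ∉ S → ∃[ w ] (w ∈ S × v ∼[ complement G ] w)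
  dominating′ v v∉S with ¬∀⟶∃¬ _ _ (λ w → w ∈? S →-dec adj G v w Bool.≟ true) (λ all → none (v , v∉S , all))
  ... | w , ¬[w∈S⇒v∼w] with w ∈? S
  ...   | no  w∉S = contradiction (λ w∈S → contradiction w∈S w∉S) ¬[w∈S⇒v∼w]
  ...   | yes w∈S = w , w∈S ,
            trans (adj-complement G (∉∈⇒≢ v∉S w∈S)) (cong not (Bool.¬-not λ v∼w → ¬[w∈S⇒v∼w] λ _ → v∼w))
  separating′ : ∀ x x′ → x ≢ x′ → x ∉ S → x′ ∉ S →
    ¬ (∀ w → w ∈ S → adj (complement G) x w ≡ adj (complement G) x′ w)
  separating′ x x′ x≢x′ x∉S x′∉S agree =
    separating x x′ x≢x′ x∉S x′∉S (complement-agree G S x∉S x′∉S agree)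

ld-set-is-side : ∀ {n} (G : Graph n) (S A : Subset n) → IsLDSet G S → IsBipartition G A →
  ∀ v → v ∉ S → v ∉ A → (∀ w → w ∈ S → v ∼[ G ] w) → S ≡ A
ld-set-is-side G S A (dominating , _) (stableA , stable∁A) v v∉S v∉A v∼S = ⊆-antisym S⊆A A⊆S
  where
  S⊆A : S ⊆ A
  S⊆A {w} w∈S with w ∈? A
  ... | yes w∈A = w∈A
  ... | no  w∉A = contradiction (trans (sym (v∼S w w∈S)) (stable∁A v w v∉A w∉A)) λ ()
  A⊆S : A ⊆ S
  A⊆S {x} x∈A with x ∈? S
  ... | yes x∈S = x∈S
  ... | no  x∉S with dominating x x∉S
  ...   | y , y∈S , x∼y = contradiction (trans (sym x∼y) (stableA x y x∈A (S⊆A y∈S))) λ ()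

∣p∪q∣≤∣p∣+∣q∣ : ∀ {n} (p q : Subset n) → ∣ p ∪ q ∣ ≤ ∣ p ∣ + ∣ q ∣
∣p∪q∣≤∣p∣+∣q∣ []            []            = z≤n
∣p∪q∣≤∣p∣+∣q∣ (outside ∷ p) (outside ∷ q) = ∣p∪q∣≤∣p∣+∣q∣ p q
∣p∪q∣≤∣p∣+∣q∣ (outside ∷ p) (inside  ∷ q) =
  ≤-trans (s≤s (∣p∪q∣≤∣p∣+∣q∣ p q)) (≤-reflexive (sym (+-suc ∣ p ∣ ∣ q ∣)))
∣p∪q∣≤∣p∣+∣q∣ (inside  ∷ p) (outside ∷ q) = s≤s (∣p∪q∣≤∣p∣+∣q∣ p q)
∣p∪q∣≤∣p∣+∣q∣ (inside  ∷ p) (inside  ∷ q) =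
  s≤s (≤-trans (∣p∪q∣≤∣p∣+∣q∣ p q) (+-monoʳ-≤ ∣ p ∣ (n≤1+n ∣ q ∣)))

element : ∀ {n} (p : Subset n) → 1 ≤ ∣ p ∣ → Nonempty p
element {n} p 1≤∣p∣ with nonempty? p
... | yes x∈p = x∈p
... | no  ∄x  = contradiction (subst (1 ≤_) (trans (cong ∣_∣ (Empty-unique ∄x)) (∣⊥∣≡0 n)) 1≤∣p∣) λ ()

other-element : ∀ {n} (p : Subset n) (u : Fin n) → 2 ≤ ∣ p ∣ → ∃[ y ] (y ∈ p × y ≢ u)
other-element p u 2≤∣p∣ with any? (λ y → y ∈? p ×-dec ¬? (y ≟ᶠ u))
... | yes found = found
... | no  none  = contradiction (≤-trans 2≤∣p∣ (≤-trans (p⊆q⇒∣p∣≤∣q∣ p⊆⁅u⁆) (≤-reflexive (∣⁅x⁆∣≡1 u))))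
                    λ { (s≤s ()) }
  where
  p⊆⁅u⁆ : p ⊆ ⁅ u ⁆
  p⊆⁅u⁆ {y} y∈p with y ≟ᶠ u
  ... | yes refl = x∈⁅x⁆ y
  ... | no  y≢u  = contradiction (y , y∈p , y≢u) none

nbhd : ∀ {n} → Graph n → Fin n → Subset n
nbhd G x = tabulate (adj G x)

nbhd-lookup : ∀ {n} (G : Graph n) x y → lookup (nbhd G x) y ≡ adj G x y
nbhd-lookup G x = lookup∘tabulate (adj G x)

module SideTraces {n} (G : Graph n) (A : Subset n) (bipartite : IsBipartition G A)
                  (A-LD : IsLDSet G A) where

  -- A vertex x ∈ ∁A has all its neighbours in A (as ∁A is stable) ...
  nbhd⊆A : ∀ {x} → x ∉ A → nbhd G x ⊆ A
  nbhd⊆A {x} x∉A {y} y∈N with y ∈? A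
  ... | yes y∈A = y∈A
  ... | no  y∉A = contradiction
    (trans (sym ([]=⇒lookup y∈N)) (trans (nbhd-lookup G x y) (proj₂ bipartite x y x∉A y∉A))) λ ()

  -- ... vertices of ∁A with equal neighbourhoods are equal (as A separates) ...
  nbhd-injective : ∀ {x x′} → x ∉ A → x′ ∉ A → nbhd G x ≡ nbhd G x′ → x ≡ x′
  nbhd-injective {x} {x′} x∉A x′∉A same with x ≟ᶠ x′
  ... | yes x≡x′ = x≡x′
  ... | no  x≢x′ = contradiction agree (proj₂ A-LD x x′ x≢x′ x∉A x′∉A)
    where
    agree : ∀ w → w ∈ A → adj G x w ≡ adj G x′ w
    agree w _ = trans (sym (nbhd-lookup G x w)) (trans (cong (λ N → lookup N w) same) (nbhd-lookup G x′ w))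

  -- ... and their neighbourhoods are non-empty (as A dominates).
  nbhd-nonempty : ∀ {x} → x ∉ A → nbhd G x ≢ ⊥
  nbhd-nonempty {x} x∉A N≡⊥ with proj₁ A-LD x x∉A
  ... | y , _ , x∼y = contradiction (begin
    true                 ≡⟨ x∼y ⟨
    adj G x y            ≡⟨ nbhd-lookup G x y ⟨
    lookup (nbhd G x) y  ≡⟨ cong (λ N → lookup N y) N≡⊥ ⟩
    lookup ⊥ y           ≡⟨ lookup-replicate y false ⟩
    false                ∎) λ ()
    where open ≡-Reasoning

  traces : Vec Bool n → Bool
  traces = image (∁ A) (nbhd G)

  count-traces : count traces ≡ ∣ ∁ A ∣
  count-traces = count-image (∁ A) (nbhd G)
    λ x∈∁A y∈∁A → nbhd-injective (x∈∁p⇒x∉p x∈∁A) (x∈∁p⇒x∉p y∈∁A)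

  -- Together with ⊥ they are distinct subsets of A, hence ∣∁A∣ + 1 ≤ 2^∣A∣.
  traces-bound : ∣ ∁ A ∣ + 1 ≤ 2 ^ ∣ A ∣
  traces-bound = begin
    ∣ ∁ A ∣ + 1                              ≡⟨ +-comm ∣ ∁ A ∣ 1 ⟩
    suc ∣ ∁ A ∣                              ≡⟨ cong suc count-traces ⟨
    suc (count traces)                       ≡⟨ count-insert traces ⊥ ⊥∉traces ⟨
    count (λ X → does (X ≟ᵛ ⊥) ∨ traces X)   ≤⟨ count-mono ⊆A ⟩
    count (λ X → does (X ⊆? A))              ≡⟨ count-⊆ A ⟩
    2 ^ ∣ A ∣                                ∎
    where
    open ≤-Reasoning
    ⊥∉traces : traces ⊥ ≡ false
    ⊥∉traces with traces ⊥ in ⊥∈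
    ... | false = refl
    ... | true with image-elim (∁ A) (nbhd G) ⊥ ⊥∈
    ...   | x , x∈∁A , ⊥≡N = contradiction (sym ⊥≡N) (nbhd-nonempty (x∈∁p⇒x∉p x∈∁A))
    ⊆A : ∀ X → does (X ≟ᵛ ⊥) ∨ traces X ≡ true → does (X ⊆? A) ≡ true
    ⊆A X X∈ with X ≟ᵛ ⊥
    ... | yes refl = dec-true (⊥ ⊆? A) (⊆-min A)
    ... | no  _ with image-elim (∁ A) (nbhd G) X X∈
    ...   | x , x∈∁A , refl = dec-true (nbhd G x ⊆? A) (nbhd⊆A (x∈∁p⇒x∉p x∈∁A))

-- For u ∈ A and a neighbour w of u, the set A′ = (A − u) ∪ {w} dominates Ḡ
-- and has ∣A′∣ ≤ ∣A∣, so it cannot separate in Ḡ; the only possible failure is a pair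
-- of twins at u: vertices of ∁A whose neighbourhoods differ exactly in u.
module TwoEdges {n} (G : Graph n) (A : Subset n) (bipartite : IsBipartition G A)
                (A-LD : IsLDSet G A)
                (larger : ∀ S → IsLDSet (complement G) S → suc ∣ A ∣ ≤ ∣ S ∣)
                (two : 2 ≤ ∣ A ∣)
                (has-neighbour : ∀ u → u ∈ A → ∃[ w ] (u ∼[ G ] w)) where

  open SideTraces G A bipartite A-LD

  stableA : ∀ x y → x ∈ A → y ∈ A → adj G x y ≡ false
  stableA = proj₁ bipartite

  stable∁A : ∀ x y → x ∉ A → y ∉ A → adj G x y ≡ false
  stable∁A = proj₂ bipartite

  Twins : Fin n → Fin n → Fin n → Set
  Twins u x x′ = x ∉ A × x′ ∉ A × adj G x u ≡ false × nbhd G x′ ≡ flip u (nbhd G x)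

  twins-edge : ∀ {u x x′} → Twins u x x′ → edge traces u (nbhd G x) ≡ true
  twins-edge {u} {x} {x′} (x∉A , x′∉A , x≁u , N′≡) =
    cong₂ (λ b c → not b ∧ c) (trans (nbhd-lookup G x u) x≁u)
      (cong₂ _∧_ (image-intro (∁ A) (nbhd G) (x∉p⇒x∈∁p x∉A))
                 (trans (cong traces (sym N′≡)) (image-intro (∁ A) (nbhd G) (x∉p⇒x∈∁p x′∉A))))

  twins-adjacent : ∀ {u x x′} → Twins u x x′ → u ∼[ G ] x′
  twins-adjacent {u} {x} {x′} (_ , _ , x≁u , N′≡) = begin
    adj G u x′                    ≡⟨ adj-sym G u x′ ⟩
    adj G x′ u                    ≡⟨ nbhd-lookup G x′ u ⟨
    lookup (nbhd G x′) u          ≡⟨ cong (λ N → lookup N u) N′≡ ⟩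
    lookup (flip u (nbhd G x)) u  ≡⟨ flip-same u (nbhd G x) ⟩
    not (lookup (nbhd G x) u)     ≡⟨ cong not (trans (nbhd-lookup G x u) x≁u) ⟩
    true                          ∎
    where open ≡-Reasoning

  twins-intro : ∀ {u x x′} → x ∉ A → x′ ∉ A → (∀ y → y ∈ A → y ≢ u → adj G x y ≡ adj G x′ y) →
    adj G x u ≡ false → adj G x′ u ≡ true → Twins u x x′
  twins-intro {u} {x} {x′} x∉A x′∉A agree x≁u x′∼u = x∉A , x′∉A , x≁u , vec-ext same
    where
    flipped : ∀ i → i ≢ u → lookup (flip u (nbhd G x)) i ≡ adj G x i
    flipped i i≢u = trans (flip-other (nbhd G x) (i≢u ∘ sym)) (nbhd-lookup G x i)
    same : ∀ i → lookup (nbhd G x′) i ≡ lookup (flip u (nbhd G x)) i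
    same i with i ≟ᶠ u
    ... | yes refl = begin
      lookup (nbhd G x′) i          ≡⟨ nbhd-lookup G x′ i ⟩
      adj G x′ i                    ≡⟨ x′∼u ⟩
      not false                     ≡⟨ cong not (trans (nbhd-lookup G x i) x≁u) ⟨
      not (lookup (nbhd G x) i)     ≡⟨ flip-same i (nbhd G x) ⟨
      lookup (flip i (nbhd G x)) i  ∎
      where open ≡-Reasoning
    ... | no  i≢u with i ∈? A
    ...   | yes i∈A = trans (nbhd-lookup G x′ i) (sym (trans (flipped i i≢u) (agree i i∈A i≢u)))
    ...   | no  i∉A = trans (nbhd-lookup G x′ i)
                        (trans (stable∁A x′ i x′∉A i∉A) (sym (trans (flipped i i≢u) (stable∁A x i x∉A i∉A))))

  -- Vertices of ∁A agreeing on A − u are twins at u in one order or the other,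
  -- since A separates them.
  agree⇒twins : ∀ {u x x′} → x ≢ x′ → x ∉ A → x′ ∉ A →
    (∀ y → y ∈ A → y ≢ u → adj G x y ≡ adj G x′ y) → Twins u x x′ ⊎ Twins u x′ x
  agree⇒twins {u} {x} {x′} x≢x′ x∉A x′∉A agree = by-cases (adj G x u) (adj G x′ u) refl refl
    where
    separated : adj G x u ≢ adj G x′ u
    separated at-u = proj₂ A-LD x x′ x≢x′ x∉A x′∉A agree-on-A
      where
      agree-on-A : ∀ y → y ∈ A → adj G x y ≡ adj G x′ y
      agree-on-A y y∈A with y ≟ᶠ u
      ... | yes refl = at-u
      ... | no  y≢u  = agree y y∈A y≢u
    by-cases : ∀ a a′ → adj G x u ≡ a → adj G x′ u ≡ a′ → Twins u x x′ ⊎ Twins u x′ x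
    by-cases false true  xu x′u = inj₁ (twins-intro x∉A x′∉A agree xu x′u)
    by-cases true  false xu x′u = inj₂ (twins-intro x′∉A x∉A (λ y y∈A y≢u → sym (agree y y∈A y≢u)) x′u xu)
    by-cases true  true  xu x′u = contradiction (trans xu (sym x′u)) separated
    by-cases false false xu x′u = contradiction (trans xu (sym x′u)) separated

  module Swap {u w} (u∈A : u ∈ A) (w∉A : w ∉ A) (u∼w : u ∼[ G ] w) where

    A′ : Subset n
    A′ = (A - u) ∪ ⁅ w ⁆

    ∣A′∣≤∣A∣ : ∣ A′ ∣ ≤ ∣ A ∣
    ∣A′∣≤∣A∣ = begin
      ∣ A′ ∣                 ≤⟨ ∣p∪q∣≤∣p∣+∣q∣ (A - u) ⁅ w ⁆ ⟩
      ∣ A - u ∣ + ∣ ⁅ w ⁆ ∣  ≡⟨ cong (∣ A - u ∣ +_) (∣⁅x⁆∣≡1 w) ⟩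
      ∣ A - u ∣ + 1         ≡⟨ +-comm ∣ A - u ∣ 1 ⟩
      suc ∣ A - u ∣         ≤⟨ x∈p⇒∣p-x∣<∣p∣ u∈A ⟩
      ∣ A ∣                 ∎
      where open ≤-Reasoning

    w∈A′ : w ∈ A′
    w∈A′ = x∈p∪q⁺ (inj₂ (x∈⁅x⁆ w))

    A∈A′ : ∀ {y} → y ∈ A → y ≢ u → y ∈ A′
    A∈A′ y∈A y≢u = x∈p∪q⁺ (inj₁ (x∈p∧x≢y⇒x∈p-y y∈A y≢u))

    outside-A′ : ∀ {v} → v ∉ A′ → v ≡ u ⊎ (v ∉ A × v ≢ w)
    outside-A′ {v} v∉A′ with v ≟ᶠ u | v ∈? A
    ... | yes v≡u | _       = inj₁ v≡u
    ... | no  v≢u | yes v∈A = contradiction (A∈A′ v∈A v≢u) v∉A′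
    ... | no  _   | no  v∉A = inj₂ (v∉A , λ { refl → v∉A′ w∈A′ })

    -- A′ dominates Ḡ: u is Ḡ-adjacent to the other vertices of A, the rest of ∁A to w.
    A′-dominates : ∀ v → v ∉ A′ → ∃[ y ] (y ∈ A′ × v ∼[ complement G ] y)
    A′-dominates v v∉A′ with outside-A′ v∉A′
    ... | inj₁ refl with other-element A u two
    ...   | y , y∈A , y≢u = y , A∈A′ y∈A y≢u , trans (adj-complement G (y≢u ∘ sym)) (cong not (stableA u y u∈A y∈A))
    A′-dominates v v∉A′ | inj₂ (v∉A , v≢w) =
      w , w∈A′ , trans (adj-complement G v≢w) (cong not (stable∁A v w v∉A w∉A))

    w-separates-u : ∀ {x} → x ∉ A → x ≢ w → adj (complement G) u w ≢ adj (complement G) x w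
    w-separates-u x∉A x≢w same = contradiction
      (trans (sym (trans (adj-complement G (∉∈⇒≢ w∉A u∈A ∘ sym)) (cong not u∼w))) (trans same
        (trans (adj-complement G x≢w) (cong not (stable∁A _ w x∉A w∉A))))) λ ()

    -- Since A′ is too small to be an LD-set of Ḡ, two vertices outside A′ are not
    -- separated in Ḡ; by the above they are twins at u in ∁A, distinct from w.
    twins : ¬ ¬ (∃[ x ] ∃[ x′ ] (Twins u x x′ × x′ ≢ w))
    twins no-twins = <-irrefl refl (≤-trans (larger A′ (A′-dominates , A′-separates)) ∣A′∣≤∣A∣)
      where
      A′-separates : ∀ x x′ → x ≢ x′ → x ∉ A′ → x′ ∉ A′ →
        ¬ (∀ y → y ∈ A′ → adj (complement G) x y ≡ adj (complement G) x′ y)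
      A′-separates x x′ x≢x′ x∉A′ x′∉A′ agree with outside-A′ x∉A′ | outside-A′ x′∉A′
      ... | inj₁ refl          | inj₁ refl            = x≢x′ refl
      ... | inj₁ refl          | inj₂ (x′∉A , x′≢w)   = w-separates-u x′∉A x′≢w (agree w w∈A′)
      ... | inj₂ (x∉A , x≢w)   | inj₁ refl            = w-separates-u x∉A x≢w (sym (agree w w∈A′))
      ... | inj₂ (x∉A , x≢w)   | inj₂ (x′∉A , x′≢w)
        with agree⇒twins x≢x′ x∉A x′∉A
               (λ y y∈A y≢u → complement-agree G A′ x∉A′ x′∉A′ agree y (A∈A′ y∈A y≢u))
      ...   | inj₁ tw = no-twins (x , x′ , tw , x′≢w)
      ...   | inj₂ tw = no-twins (x′ , x , tw , x≢w)

  -- Every u ∈ A carries at least two edges of the trace family: the swap argument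
  -- with a neighbour w₀ gives twins (x₁, x₁′); again with w = x₁′ it gives twins
  -- (x₂, x₂′) with x₂′ ≢ x₁′, and then the bottoms nbhd x₁, nbhd x₂ differ.
  two-edges : ∀ u → u ∈ A → 2 ≤ edges traces u
  two-edges u u∈A with has-neighbour u u∈A
  ... | w₀ , u∼w₀ = decidable-stable (2 ≤? edges traces u) λ fewer →
    Swap.twins u∈A w₀∉A u∼w₀ λ (x₁ , x₁′ , tw₁@(_ , x₁′∉A , _) , _) →
    Swap.twins u∈A x₁′∉A (twins-adjacent tw₁) λ (x₂ , x₂′ , tw₂ , x₂′≢x₁′) →
    fewer (count-members (edge traces u) (nbhd G x₁ ∷ nbhd G x₂ ∷ [])
             ((different tw₁ tw₂ x₂′≢x₁′ ∷ []) ∷ [] ∷ [])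
             (twins-edge tw₁ ∷ twins-edge tw₂ ∷ []))
    where
    w₀∉A : w₀ ∉ A
    w₀∉A w₀∈A = contradiction (trans (sym u∼w₀) (stableA u w₀ u∈A w₀∈A)) λ ()
    different : ∀ {x₁ x₁′ x₂ x₂′} → Twins u x₁ x₁′ → Twins u x₂ x₂′ → x₂′ ≢ x₁′ → nbhd G x₁ ≢ nbhd G x₂
    different (_ , x₁′∉A , _ , N₁′≡) (_ , x₂′∉A , _ , N₂′≡) x₂′≢x₁′ N₁≡N₂ =
      x₂′≢x₁′ (nbhd-injective x₂′∉A x₁′∉A (trans N₂′≡ (trans (cong (flip u) (sym N₁≡N₂)) (sym N₁′≡))))

side-bounds : ∀ {n} (G : Graph n) (A : Subset n) → Connected G → IsBipartition G A →
  IsLDSet G A → (∀ S → IsLDSet (complement G) S → suc ∣ A ∣ ≤ ∣ S ∣) → 2 ≤ ∣ A ∣ → 1 ≤ ∣ ∁ A ∣ →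
  (3 * ∣ A ∣ ≤ 2 * ∣ ∁ A ∣) × (∣ ∁ A ∣ + 1 ≤ 2 ^ ∣ A ∣)
side-bounds G A connected bipartite A-LD larger two ∁A-nonempty = lower , traces-bound
  where
  open SideTraces G A bipartite A-LD
  z∈∁A : proj₁ (element (∁ A) ∁A-nonempty) ∈ ∁ A
  z∈∁A = proj₂ (element (∁ A) ∁A-nonempty)
  -- A path from u ∈ A to a vertex of ∁A starts with a neighbour of u.
  has-neighbour : ∀ u → u ∈ A → ∃[ w ] (u ∼[ G ] w)
  has-neighbour u u∈A with connected u (proj₁ (element (∁ A) ∁A-nonempty))
  ... | here             = contradiction u∈A (x∈∁p⇒x∉p z∈∁A)
  ... | step {v = w} u∼w _ = w , u∼w
  open TwoEdges G A bipartite A-LD larger two has-neighbour using (two-edges)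
  lower : 3 * ∣ A ∣ ≤ 2 * ∣ ∁ A ∣
  lower = begin
    3 * ∣ A ∣           ≤⟨ m≤m+n (3 * ∣ A ∣) 2 ⟩
    3 * ∣ A ∣ + 2       ≤⟨ direction-bound traces A (subst (1 ≤_) (sym count-traces) ∁A-nonempty) two-edges ⟩
    2 * count traces    ≡⟨ cong (2 *_) count-traces ⟩
    2 * ∣ ∁ A ∣         ∎
    where open ≤-Reasoning

bipartition-∁ : ∀ {n} (G : Graph n) (A : Subset n) → IsBipartition G A → IsBipartition G (∁ A)
bipartition-∁ G A (stableA , stable∁A) =
  (λ x y x∈∁A y∈∁A → stable∁A x y (x∈∁p⇒x∉p x∈∁A) (x∈∁p⇒x∉p y∈∁A)) ,
  (λ x y x∉∁A y∉∁A → stableA x y (x∉∁p⇒x∈p x∉∁A) (x∉∁p⇒x∈p y∉∁A))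

∣∁∁p∣≡∣p∣ : ∀ {n} (p : Subset n) → ∣ ∁ (∁ p) ∣ ≡ ∣ p ∣
∣∁∁p∣≡∣p∣ {n} p = trans (∣∁p∣≡n∸∣p∣ (∁ p)) (trans (cong (n ∸_) (∣∁p∣≡n∸∣p∣ p)) (m∸[m∸n]≡n (∣p∣≤n p)))

three-halves-collapse : ∀ {r s} → r ≤ s → 3 * s ≤ 2 * r → s ≡ 0
three-halves-collapse {r} {s} r≤s 3s≤2r =
  n≤0⇒n≡0 (+-cancelʳ-≤ (2 * s) s 0 (≤-trans 3s≤2r (*-monoʳ-≤ 2 r≤s)))

complement-larger : ∀ {n} (G : Graph n) (S : Subset n) {k} → ∣ S ∣ ≡ k →
  IsLocDomNumber (complement G) (k + 1) → ∀ S′ → IsLDSet (complement G) S′ → suc ∣ S ∣ ≤ ∣ S′ ∣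
complement-larger G S {k} ∣S∣≡k (_ , minimum) S′ S′-LD =
  subst (_≤ ∣ S′ ∣) (trans (+-comm k 1) (cong suc (sym ∣S∣≡k))) (minimum S′ S′-LD)

-- Such an LD-set S of a bipartite graph is one of the two sides: some v ∉ S is
-- adjacent to all of S, and S is the side not containing v.
minimum-is-side : ∀ {n} (G : Graph n) (U S : Subset n) → IsBipartition G U → IsLDSet G S →
  (∀ S′ → IsLDSet (complement G) S′ → suc ∣ S ∣ ≤ ∣ S′ ∣) → S ≡ U ⊎ S ≡ ∁ U
minimum-is-side G U S bipartite S-LD larger with full-neighbour G S S-LD larger
... | v , v∉S , v∼S with v ∈? U
...   | no  v∉U = inj₁ (ld-set-is-side G S U S-LD bipartite v v∉S v∉U v∼S)
...   | yes v∈U = inj₂ (ld-set-is-side G S (∁ U) S-LD (bipartition-∁ G U bipartite) v v∉S (x∈p⇒x∉∁p v∈U) v∼S)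

-- Proof of the theorem: a minimum LD-set S of G is a side.  If S = U, the side
-- bounds are the claim; S = ∁U is impossible, since the side bound 3s ≤ 2r
-- contradicts 3 ≤ r ≤ s.
proposition4p7 : (n : ℕ) (G : Graph n) (U : Subset n) →
    Connected G → IsBipartition G U →
    4 ≤ n → 1 ≤ ∣ U ∣ → ∣ U ∣ ≤ ∣ ∁ U ∣ → 3 ≤ ∣ U ∣ →
    (k : ℕ) → IsLocDomNumber G k → IsLocDomNumber (complement G) (k + 1) →
    (3 * ∣ U ∣ ≤ 2 * ∣ ∁ U ∣) × (∣ ∁ U ∣ + 1 ≤ 2 ^ ∣ U ∣)
proposition4p7 n G U connected bipartite _ r≥1 r≤s r≥3 k ((S , S-LD , ∣S∣≡k) , _) λḠ≡k+1
  with complement-larger G S ∣S∣≡k λḠ≡k+1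
... | larger with minimum-is-side G U S bipartite S-LD larger
...   | inj₁ refl = side-bounds G U connected bipartite S-LD larger (≤-trans (s≤s (s≤s z≤n)) r≥3) (≤-trans r≥1 r≤s)
...   | inj₂ refl = contradiction (subst (3 ≤_) s≡0 (≤-trans r≥3 r≤s)) λ ()
  where
  r≥1′ : 1 ≤ ∣ ∁ (∁ U) ∣
  r≥1′ = subst (1 ≤_) (sym (∣∁∁p∣≡∣p∣ U)) r≥1
  3s≤2r : 3 * ∣ ∁ U ∣ ≤ 2 * ∣ U ∣
  3s≤2r = subst (λ m → 3 * ∣ ∁ U ∣ ≤ 2 * m) (∣∁∁p∣≡∣p∣ U)
    (proj₁ (side-bounds G (∁ U) connected (bipartition-∁ G U bipartite) S-LD larger
             (≤-trans (s≤s (s≤s z≤n)) (≤-trans r≥3 r≤s)) r≥1′))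
  s≡0 : ∣ ∁ U ∣ ≡ 0
  s≡0 = three-halves-collapse r≤s 3s≤2r
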